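{- Let $2\le a\le b\le c$ be integers and let $m(a,b,c)=F(a)^2+F(b)^2+F(c)^2-3F(a)F(b)F(c)$. Then $m(a,b,c)>0$ if and only if either $c\ge a+b+1$, or $(a,b,c)=(2,b,b+2)$ for some even $b\ge 2$.
   Context: $F(n)$ denotes the $n$-th Fibonacci number, $F(0)=0$, $F(1)=1$, $F(n+1)=F(n)+F(n-1)$. -}

module Defs where

open import Data.Nat using (ℕ; zero; suc; _+_)
open import Data.Integer as ℤ using (ℤ; +_)

F : ℕ → ℕ
F zero = zero
F (suc zero) = suc zero
F (suc (suc n)) = F (suc n) + F n

m : ℕ → ℕ → ℕ → ℤ
m a b c = (A ℤ.* A ℤ.+ B ℤ.* B ℤ.+ C ℤ.* C) ℤ.- (+ 3) ℤ.* A ℤ.* B ℤ.* C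
  where
  A = + F a
  B = + F b
  C = + F c

{-# OPTIONS --safe #-}
-- Put A, B, C = F a, F b, F c. As a convex quadratic in C whose roots sum to 3AB,
-- m = A² + B² + C² − 3ABC is non-positive for B ≤ C ≤ 3AB − B (it is at C = B,
-- since A ≤ B) and positive once C ≥ 3AB. The addition formula
-- F(a+b+1) = F(a+1)F(b+1) + F(a)F(b) together with 3F(n) ≤ 2F(n+1) (n ≥ 2) gives
-- F(a+b+1) ≥ 3AB, and for a ≥ 3 it gives F(a+b) + B ≤ 3AB; for a = 2 and c ≤ b + 1
-- one has C ≤ 2B = 3AB − B. The remaining case a = 2, c = b + 2 is decided by
-- Cassini's identity, which makes m(2, b, b+2) = 1 + (−1)^b.
module Submission where

open import Defs
open import Data.Nat using (ℕ; _+_; _≤_)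
open import Data.Nat.Divisibility using (_∣_)
open import Data.Integer using (+_) renaming (_<_ to _<ℤ_)
open import Data.Product using (_×_)
open import Data.Sum using (_⊎_)
open import Function.Bundles using (_⇔_)
open import Relation.Binary.PropositionalEquality using (_≡_)

open import Data.Nat using (zero; suc; _*_; _∸_; _<_; _≤′_; ≤′-refl; ≤′-step; z≤n; s≤s; _≤?_)
open import Data.Nat.Properties
open import Data.Nat.Divisibility using (divides)
open import Data.Nat.Tactic.RingSolver using (solve)
open import Data.Integer as ℤ using (_⊖_)
open import Data.Integer.Properties as ℤₚ using (pos-+; pos-*; n⊖n≡0; ⊖-monoˡ-≤; ⊖-monoˡ-<; [+m]-[+n]≡m⊖n)
open import Data.List using ([]; _∷_)
open import Data.Product using (_,_; ∃-syntax)
open import Data.Sum using (inj₁; inj₂)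
open import Function.Bundles using (mk⇔)
open import Function.Properties.Equivalence using () renaming (trans to ⇔-trans)
open import Relation.Binary.PropositionalEquality using (refl; sym; trans; cong; cong₂; subst; module ≡-Reasoning)
open import Relation.Nullary using (¬_; yes; no; contradiction)

MarkovPositive : ℕ → ℕ → ℕ → Set
MarkovPositive x y z = 3 * x * y * z < x * x + y * y + z * z

3xy≤z⇒markovPositive : ∀ {x y z} → 0 < x → 3 * x * y ≤ z → MarkovPositive x y z
3xy≤z⇒markovPositive {x} {y} {z} 0<x 3xy≤z = begin-strict
  3 * x * y * z          ≤⟨ *-monoˡ-≤ z 3xy≤z ⟩
  z * z                  <⟨ m<n+m (z * z) 0<xx+yy ⟩
  x * x + y * y + z * z  ∎
  where
  open ≤-Reasoning
  0<xx+yy : 0 < x * x + y * y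
  0<xx+yy = ≤-trans (*-mono-≤ 0<x 0<x) (m≤m+n (x * x) (y * y))

x*[y+z]≤y*z+x*x : ∀ {x y z} → x ≤ y → x ≤ z → x * (y + z) ≤ y * z + x * x
x*[y+z]≤y*z+x*x {x} x≤y x≤z with m≤n⇒∃[o]m+o≡n x≤y | m≤n⇒∃[o]m+o≡n x≤z
... | u , refl | v , refl = begin
  x * ((x + u) + (x + v))          ≤⟨ m≤m+n _ (u * v) ⟩
  x * ((x + u) + (x + v)) + u * v  ≡⟨ solve (x ∷ u ∷ v ∷ []) ⟩
  (x + u) * (x + v) + x * x        ∎
  where open ≤-Reasoning

z+y≤3xy⇒¬markovPositive : ∀ {x y z} → 0 < x → x ≤ y → y ≤ z → z + y ≤ 3 * x * y →
                          ¬ MarkovPositive x y z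
z+y≤3xy⇒¬markovPositive {x} {y} {z} 0<x x≤y y≤z z+y≤s = ≤⇒≯ (begin
  x * x + y * y + z * z  ≤⟨ +-monoˡ-≤ (z * z) xx+yy≤zt ⟩
  z * t + z * z          ≡⟨ *-distribˡ-+ z t z ⟨
  z * (t + z)            ≡⟨ cong (z *_) (trans (+-comm t z) z+t≡s) ⟩
  z * s                  ≡⟨ *-comm z s ⟩
  s * z                  ∎)
  where
  open ≤-Reasoning
  s = 3 * x * y
  t = s ∸ z
  z+t≡s : z + t ≡ s
  z+t≡s = m+[n∸m]≡n (≤-trans (m≤m+n z y) z+y≤s)
  y≤t : y ≤ t
  y≤t = +-cancelˡ-≤ z y t (subst (z + y ≤_) (sym z+t≡s) z+y≤s)
  xx+yy+yy≤ys : x * x + y * y + y * y ≤ y * s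
  xx+yy+yy≤ys = begin
    x * x + y * y + y * y  ≤⟨ +-monoˡ-≤ (y * y) (+-monoˡ-≤ (y * y) (*-mono-≤ x≤y x≤y)) ⟩
    y * y + y * y + y * y  ≡⟨ solve (y ∷ []) ⟩
    1 * (3 * (y * y))      ≤⟨ *-monoˡ-≤ (3 * (y * y)) 0<x ⟩
    x * (3 * (y * y))      ≡⟨ solve (x ∷ y ∷ []) ⟩
    y * (3 * x * y)        ∎
  xx+yy≤zt : x * x + y * y ≤ z * t
  xx+yy≤zt = +-cancelʳ-≤ (y * y) _ _ (begin
    x * x + y * y + y * y  ≤⟨ xx+yy+yy≤ys ⟩
    y * s                  ≡⟨ cong (y *_) z+t≡s ⟨
    y * (z + t)            ≤⟨ x*[y+z]≤y*z+x*x y≤z y≤t ⟩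
    z * t + y * y          ∎)

x*x≡x*y+y*y+1⇒markovPositive : ∀ x y → x * x ≡ x * y + y * y + 1 → MarkovPositive 1 y (x + y)
x*x≡x*y+y*y+1⇒markovPositive x y cassini = begin-strict
  3 * 1 * y * (x + y)                                  <⟨ m<n+m _ (s≤s z≤n) ⟩
  2 + 3 * 1 * y * (x + y)                              ≡⟨ solve (x ∷ y ∷ []) ⟩
  1 + 2 * (y * y) + 2 * (x * y) + (x * y + y * y + 1)  ≡⟨ cong (λ w → 1 + 2 * (y * y) + 2 * (x * y) + w) cassini ⟨
  1 + 2 * (y * y) + 2 * (x * y) + x * x                ≡⟨ solve (x ∷ y ∷ []) ⟩
  1 * 1 + y * y + (x + y) * (x + y)                    ∎
  where open ≤-Reasoning

x*x+1≡x*y+y*y⇒¬markovPositive : ∀ x y → x * x + 1 ≡ x * y + y * y → ¬ MarkovPositive 1 y (x + y)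
x*x+1≡x*y+y*y⇒¬markovPositive x y cassini = ≤⇒≯ (≤-reflexive (begin
  1 * 1 + y * y + (x + y) * (x + y)            ≡⟨ solve (x ∷ y ∷ []) ⟩
  2 * (y * y) + 2 * (x * y) + (x * x + 1)      ≡⟨ cong (λ w → 2 * (y * y) + 2 * (x * y) + w) cassini ⟩
  2 * (y * y) + 2 * (x * y) + (x * y + y * y)  ≡⟨ solve (x ∷ y ∷ []) ⟩
  3 * 1 * y * (x + y)                          ∎))
  where open ≡-Reasoning

F[n]≤F[1+n] : ∀ n → F n ≤ F (suc n)
F[n]≤F[1+n] zero = z≤n
F[n]≤F[1+n] (suc n) = m≤m+n (F (suc n)) (F n)

F-mono : ∀ {m n} → m ≤ n → F m ≤ F n
F-mono m≤n = mono′ (≤⇒≤′ m≤n)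
  where
  mono′ : ∀ {m n} → m ≤′ n → F m ≤ F n
  mono′ ≤′-refl = ≤-refl
  mono′ {n = suc n} (≤′-step m≤′n) = ≤-trans (mono′ m≤′n) (F[n]≤F[1+n] n)

F-pos : ∀ {n} → 0 < n → 0 < F n
F-pos = F-mono {1}

F-add : ∀ m n → F (suc (m + n)) ≡ F (suc m) * F (suc n) + F m * F n
F-add zero n = sym (trans (+-identityʳ _) (*-identityˡ _))
F-add (suc zero) n = sym (cong₂ _+_ (*-identityˡ (F (suc n))) (*-identityˡ (F n)))
F-add (suc (suc m)) n = begin
  F (suc (suc m + n)) + F (suc m + n)
    ≡⟨ cong₂ _+_ (F-add (suc m) n) (F-add m n) ⟩
  (F (suc (suc m)) * F (suc n) + F (suc m) * F n) + (F (suc m) * F (suc n) + F m * F n)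
    ≡⟨ regroup (F (suc (suc m))) (F (suc m)) (F m) (F (suc n)) (F n) ⟩
  F (suc (suc (suc m))) * F (suc n) + F (suc (suc m)) * F n
    ∎
  where
  open ≡-Reasoning
  regroup : ∀ x₂ x₁ x₀ y₁ y₀ →
            (x₂ * y₁ + x₁ * y₀) + (x₁ * y₁ + x₀ * y₀) ≡ (x₂ + x₁) * y₁ + (x₁ + x₀) * y₀
  regroup x₂ x₁ x₀ y₁ y₀ = solve (x₂ ∷ x₁ ∷ x₀ ∷ y₁ ∷ y₀ ∷ [])

F[n]<F[1+n] : ∀ {n} → 2 ≤ n → F n < F (suc n)
F[n]<F[1+n] {suc (suc k)} (s≤s (s≤s z≤n)) = m<m+n (F (suc (suc k))) (F-pos {suc k} (s≤s z≤n))

F[1+n]≤2F[n] : ∀ {n} → 0 < n → F (suc n) ≤ 2 * F n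
F[1+n]≤2F[n] {suc k} (s≤s z≤n) = +-monoʳ-≤ (F (suc k)) (≤-trans (F[n]≤F[1+n] k) (m≤m+n _ 0))

3F[n]≤2F[1+n] : ∀ {n} → 2 ≤ n → 3 * F n ≤ 2 * F (suc n)
3F[n]≤2F[1+n] {suc (suc k)} (s≤s (s≤s z≤n)) = core (F[n]≤F[1+n] k)
  where
  core : ∀ {x y} → y ≤ x → 3 * (x + y) ≤ 2 * (x + y + x)
  core {x} {y} y≤x = begin
    3 * (x + y)          ≡⟨ solve (x ∷ y ∷ []) ⟩
    3 * x + 2 * y + y    ≤⟨ +-monoʳ-≤ (3 * x + 2 * y) y≤x ⟩
    3 * x + 2 * y + x    ≡⟨ solve (x ∷ y ∷ []) ⟩
    2 * (x + y + x)      ∎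
    where open ≤-Reasoning

3FaFb≤F[1+a+b] : ∀ {a b} → 2 ≤ a → 2 ≤ b → 3 * F a * F b ≤ F (suc (a + b))
3FaFb≤F[1+a+b] {a} {b} 2≤a 2≤b = subst (3 * F a * F b ≤_) (sym (F-add a b))
  (core (F a) (F (suc a)) (F b) (F (suc b)) (3F[n]≤2F[1+n] 2≤a) (3F[n]≤2F[1+n] 2≤b))
  where
  core : ∀ x x′ y y′ → 3 * x ≤ 2 * x′ → 3 * y ≤ 2 * y′ → 3 * x * y ≤ x′ * y′ + x * y
  core x x′ y y′ 3x≤2x′ 3y≤2y′ = *-cancelˡ-≤ 4 (begin
    4 * (3 * x * y)                    ≡⟨ solve (x ∷ y ∷ []) ⟩
    3 * x * (3 * y) + 3 * (x * y)      ≤⟨ +-mono-≤ (*-mono-≤ 3x≤2x′ 3y≤2y′) (*-monoˡ-≤ (x * y) (n≤1+n 3)) ⟩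
    2 * x′ * (2 * y′) + 4 * (x * y)    ≡⟨ solve (x ∷ x′ ∷ y ∷ y′ ∷ []) ⟩
    4 * (x′ * y′ + x * y)              ∎)
    where open ≤-Reasoning

F[a+b]+F[b]≤3FaFb : ∀ {a b} → 3 ≤ a → 0 < b → F (a + b) + F b ≤ 3 * F a * F b
F[a+b]+F[b]≤3FaFb {suc a′} {b} (s≤s 2≤a′) 0<b = begin
  F (suc (a′ + b)) + F b                     ≡⟨ cong (_+ F b) (F-add a′ b) ⟩
  F (suc a′) * F (suc b) + F a′ * F b + F b  ≤⟨ core (F (suc a′)) (F a′) (F b) (F (suc b))
                                                      (F[n]<F[1+n] 2≤a′) (F[1+n]≤2F[n] 0<b) ⟩
  3 * F (suc a′) * F b                       ∎
  where
  open ≤-Reasoning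
  core : ∀ x x′ y y′ → x′ < x → y′ ≤ 2 * y → x * y′ + x′ * y + y ≤ 3 * x * y
  core x x′ y y′ x′<x y′≤2y = begin
    x * y′ + x′ * y + y        ≡⟨ solve (x ∷ x′ ∷ y ∷ y′ ∷ []) ⟩
    x * y′ + (1 + x′) * y      ≤⟨ +-mono-≤ (*-monoʳ-≤ x y′≤2y) (*-monoˡ-≤ y x′<x) ⟩
    x * (2 * y) + x * y        ≡⟨ solve (x ∷ y ∷ []) ⟩
    3 * x * y                  ∎

cassini-even : ∀ k → F (suc (k * 2)) * F (suc (k * 2)) ≡
                     F (suc (k * 2)) * F (k * 2) + F (k * 2) * F (k * 2) + 1
cassini-odd : ∀ k → F (2 + k * 2) * F (2 + k * 2) + 1 ≡
                    F (2 + k * 2) * F (suc (k * 2)) + F (suc (k * 2)) * F (suc (k * 2))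

cassini-even zero = refl
cassini-even (suc k) = step (F (2 + k * 2)) (F (suc (k * 2))) (cassini-odd k)
  where
  step : ∀ x y → x * x + 1 ≡ x * y + y * y → (x + y) * (x + y) ≡ (x + y) * x + x * x + 1
  step x y odd = begin
    (x + y) * (x + y)                ≡⟨ solve (x ∷ y ∷ []) ⟩
    x * x + x * y + (x * y + y * y)  ≡⟨ cong (λ w → x * x + x * y + w) odd ⟨
    x * x + x * y + (x * x + 1)      ≡⟨ solve (x ∷ y ∷ []) ⟩
    (x + y) * x + x * x + 1          ∎
    where open ≡-Reasoning
cassini-odd k = step (F (suc (k * 2))) (F (k * 2)) (cassini-even k)
  where
  step : ∀ x y → x * x ≡ x * y + y * y + 1 → (x + y) * (x + y) + 1 ≡ (x + y) * x + x * x
  step x y even = begin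
    (x + y) * (x + y) + 1                ≡⟨ solve (x ∷ y ∷ []) ⟩
    (x * y + y * y + 1) + x * y + x * x  ≡⟨ cong (λ w → w + x * y + x * x) even ⟨
    x * x + x * y + x * x                ≡⟨ solve (x ∷ y ∷ []) ⟩
    (x + y) * x + x * x                  ∎
    where open ≡-Reasoning

even⊎odd : ∀ n → 2 ∣ n ⊎ ∃[ k ] n ≡ suc (k * 2)
even⊎odd zero = inj₁ (divides 0 refl)
even⊎odd (suc n) with even⊎odd n
... | inj₁ (divides k refl) = inj₂ (k , refl)
... | inj₂ (k , refl)       = inj₁ (divides (suc k) refl)

markovPositive-F[2k] : ∀ k → MarkovPositive (F 2) (F (k * 2)) (F (2 + k * 2))
markovPositive-F[2k] k = x*x≡x*y+y*y+1⇒markovPositive (F (suc (k * 2))) (F (k * 2)) (cassini-even k)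

markovPositive-F[b+2]⇒2∣b : ∀ b → MarkovPositive (F 2) (F b) (F (2 + b)) → 2 ∣ b
markovPositive-F[b+2]⇒2∣b b pos with even⊎odd b
... | inj₁ 2∣b         = 2∣b
... | inj₂ (k , refl) =
  contradiction pos (x*x+1≡x*y+y*y⇒¬markovPositive (F (2 + k * 2)) (F (suc (k * 2))) (cassini-odd k))

0<m⊖n⇔n<m : ∀ m n → + 0 <ℤ m ⊖ n ⇔ n < m
0<m⊖n⇔n<m m n = mk⇔ to from
  where
  to : + 0 <ℤ m ⊖ n → n < m
  to 0<m⊖n = ≰⇒> λ m≤n → ℤₚ.≤⇒≯ (subst (m ⊖ n ℤ.≤_) (n⊖n≡0 n) (⊖-monoˡ-≤ n m≤n)) 0<m⊖n
  from : n < m → + 0 <ℤ m ⊖ n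
  from n<m = subst (ℤ._< m ⊖ n) (n⊖n≡0 n) (⊖-monoˡ-< n n<m)

m≡squares⊖3product : ∀ a b c → m a b c ≡ (F a * F a + F b * F b + F c * F c) ⊖ (3 * F a * F b * F c)
m≡squares⊖3product a b c =
  trans (cong₂ ℤ._-_ (sym (pos-squares (F a) (F b) (F c))) (sym (pos-3product (F a) (F b) (F c))))
        ([+m]-[+n]≡m⊖n (F a * F a + F b * F b + F c * F c) (3 * F a * F b * F c))
  where
  pos-squares : ∀ x y z → + (x * x + y * y + z * z) ≡ + x ℤ.* + x ℤ.+ + y ℤ.* + y ℤ.+ + z ℤ.* + z
  pos-squares x y z = trans (pos-+ (x * x + y * y) (z * z))
    (cong₂ ℤ._+_ (trans (pos-+ (x * x) (y * y)) (cong₂ ℤ._+_ (pos-* x x) (pos-* y y))) (pos-* z z))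
  pos-3product : ∀ x y z → + (3 * x * y * z) ≡ + 3 ℤ.* + x ℤ.* + y ℤ.* + z
  pos-3product x y z =
    trans (pos-* (3 * x * y) z) (cong (ℤ._* + z) (trans (pos-* (3 * x) y) (cong (ℤ._* + y) (pos-* 3 x))))

0<m⇔markovPositive : ∀ a b c → + 0 <ℤ m a b c ⇔ MarkovPositive (F a) (F b) (F c)
0<m⇔markovPositive a b c rewrite m≡squares⊖3product a b c = 0<m⊖n⇔n<m _ _

¬markovPositive-F[3≤a] : ∀ {a b c} → 3 ≤ a → a ≤ b → b ≤ c → c ≤ a + b →
                         ¬ MarkovPositive (F a) (F b) (F c)
¬markovPositive-F[3≤a] {a} {b} {c} 3≤a a≤b b≤c c≤a+b =
  z+y≤3xy⇒¬markovPositive (F-pos 0<a) (F-mono a≤b) (F-mono b≤c)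
    (≤-trans (+-monoˡ-≤ (F b) (F-mono c≤a+b)) (F[a+b]+F[b]≤3FaFb 3≤a (≤-trans 0<a a≤b)))
  where
  0<a : 0 < a
  0<a = ≤-trans (s≤s z≤n) 3≤a

markovPositive-F[2]⇒ : ∀ {b c} → 2 ≤ b → b ≤ c → c ≤ 2 + b → MarkovPositive (F 2) (F b) (F c) →
                       2 ∣ b × c ≡ b + 2
markovPositive-F[2]⇒ {b} {c} 2≤b b≤c c≤2+b pos with c ≤? suc b
... | yes c≤1+b = contradiction pos
  (z+y≤3xy⇒¬markovPositive (s≤s z≤n) (F-pos 0<b) (F-mono b≤c) (begin
    F c + F b      ≤⟨ +-monoˡ-≤ (F b) (≤-trans (F-mono c≤1+b) (F[1+n]≤2F[n] 0<b)) ⟩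
    2 * F b + F b  ≡⟨ +-comm (2 * F b) (F b) ⟩
    3 * 1 * F b    ∎))
  where
  open ≤-Reasoning
  0<b : 0 < b
  0<b = <⇒≤ 2≤b
... | no c≰1+b with ≤-antisym c≤2+b (≰⇒> c≰1+b)
...   | refl = markovPositive-F[b+2]⇒2∣b b pos , +-comm 2 b

markovPositive-F⇒ : ∀ {a b c} → 2 ≤ a → a ≤ b → b ≤ c → MarkovPositive (F a) (F b) (F c) →
                    (a + b + 1 ≤ c) ⊎ (a ≡ 2 × 2 ∣ b × c ≡ b + 2)
markovPositive-F⇒ {a} {b} {c} 2≤a a≤b b≤c pos with c ≤? a + b | m≤n⇒m<n∨m≡n 2≤a
... | no c≰a+b  | _         = inj₁ (subst (_≤ c) (+-comm 1 (a + b)) (≰⇒> c≰a+b))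
... | yes c≤a+b | inj₁ 3≤a  = contradiction pos (¬markovPositive-F[3≤a] 3≤a a≤b b≤c c≤a+b)
... | yes c≤a+b | inj₂ refl = inj₂ (refl , markovPositive-F[2]⇒ a≤b b≤c c≤a+b pos)

markovPositive-F⇐ : ∀ {a b c} → 2 ≤ a → a ≤ b → (a + b + 1 ≤ c) ⊎ (a ≡ 2 × 2 ∣ b × c ≡ b + 2) →
                    MarkovPositive (F a) (F b) (F c)
markovPositive-F⇐ {a} {b} {c} 2≤a a≤b (inj₁ a+b+1≤c) =
  3xy≤z⇒markovPositive (F-pos (<⇒≤ 2≤a))
    (≤-trans (3FaFb≤F[1+a+b] 2≤a (≤-trans 2≤a a≤b)) (F-mono (subst (_≤ c) (+-comm (a + b) 1) a+b+1≤c)))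
markovPositive-F⇐ _ _ (inj₂ (refl , divides k refl , refl)) =
  subst (λ n → MarkovPositive (F 2) (F (k * 2)) (F n)) (+-comm 2 (k * 2)) (markovPositive-F[2k] k)

proposition3p4 : (a b c : ℕ) → 2 ≤ a → a ≤ b → b ≤ c →
    ((+ 0) <ℤ m a b c) ⇔ ((a + b + 1 ≤ c) ⊎ (a ≡ 2 × 2 ∣ b × c ≡ b + 2))
proposition3p4 a b c 2≤a a≤b b≤c =
  ⇔-trans (0<m⇔markovPositive a b c)
          (mk⇔ (markovPositive-F⇒ 2≤a a≤b b≤c) (markovPositive-F⇐ 2≤a a≤b))
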